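{- Let $\mathbf{D}$ be a double Boolean algebra. A subset $X\subseteq\mathcal{F}_{pr}(\mathbf{D})$ is clopen in $(\mathcal{F}_{pr}(\mathbf{D}),\mathcal{T})$ if and only if $X=F_x$ for some $x\in D$; and a subset $Y\subseteq\mathcal{I}_{pr}(\mathbf{D})$ is clopen in $(\mathcal{I}_{pr}(\mathbf{D}),\mathcal{J})$ if and only if $Y=I_x$ for some $x\in D$.
   Context: For an algebra $(D;\sqcap,\sqcup,\neg,\lrcorner,\top,\bot)$ of type $(2,2,1,1,0,0)$ write $x\vee y:=\neg(\neg x\sqcap\neg y)$, $x\wedge y:=\lrcorner(\lrcorner x\sqcup\lrcorner y)$. A double Boolean algebra (dBa) is such an algebra satisfying, for all $x,y,z$: $(x\sqcap x)\sqcap y=x\sqcap y$; $(x\sqcup x)\sqcup y=x\sqcup y$; $x\sqcap y=y\sqcap x$; $x\sqcup y=y\sqcup x$; $\neg(x\sqcap x)=\neg x$; $\lrcorner(x\sqcup x)=\lrcorner x$; $x\sqcap(x\sqcup y)=x\sqcap x$; $x\sqcup(x\sqcap y)=x\sqcup x$; $x\sqcap(y\vee z)=(x\sqcap y)\vee(x\sqcap z)$; $x\sqcup(y\wedge z)=(x\sqcup y)\wedge(x\sqcup z)$; $x\sqcap(x\vee y)=x\sqcap x$; $x\sqcup(x\wedge y)=x\sqcup x$; $\neg\neg(x\sqcap y)=x\sqcap y$; $\lrcorner\lrcorner(x\sqcup y)=x\sqcup y$; $x\sqcap\neg x=\bot$; $x\sqcup\lrcorner x=\top$; $\neg\top=\bot$;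 $\lrcorner\bot=\top$; $x\sqcap(y\sqcap z)=(x\sqcap y)\sqcap z$; $x\sqcup(y\sqcup z)=(x\sqcup y)\sqcup z$; $\neg\bot=\top\sqcap\top$; $\lrcorner\top=\bot\sqcup\bot$; $(x\sqcap x)\sqcup(x\sqcap x)=(x\sqcup x)\sqcap(x\sqcup x)$. Put $x\sqsubseteq y$ iff $x\sqcap y=x\sqcap x$ and $x\sqcup y=y\sqcup y$. A filter is $F\subseteq D$ closed under $\sqcap$ and upward closed w.r.t. $\sqsubseteq$; an ideal is $I\subseteq D$ closed under $\sqcup$ and downward closed w.r.t. $\sqsubseteq$. Primary filter: nonempty filter $F\neq D$ with $x\in F$ or $\neg x\in F$ for all $x$; primary ideal: nonempty ideal $I\neq D$ with $x\in I$ or $\lrcorner x\in I$ for all $x$. $\mathcal{F}_{pr}(\mathbf{D})$ and $\mathcal{I}_{pr}(\mathbf{D})$ are the sets of primary filters and primary ideals; $F_x=\{F\in\mathcal{F}_{pr}(\mathbf{D})\mid x\in F\}$, $I_x=\{I\in\mathcal{I}_{pr}(\mathbf{D})\mid x\in I\}$. $\mathcal{T}$ is the topology on $\mathcal{F}_{pr}(\mathbf{D})$ with $\{F_x\mid x\in D\}$ as a subbase for the closed sets; $\mathcal{J}$ is the topology on $\mathcal{I}_{pr}(\mathbf{D})$ with $\{I_x\mid x\in D\}$ as a subbase for the closed sets. -}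

module Defs where

open import Level using (Level; _⊔_) renaming (suc to lsuc)
open import Relation.Binary.PropositionalEquality using (_≡_)
open import Relation.Unary using (Pred; _⊆_; ∁)
open import Data.Product using (Σ; _×_; _,_; ∃)
open import Data.Sum using (_⊎_)
open import Data.List using (List)
open import Data.List.Relation.Unary.Any using (Any)
open import Relation.Nullary using (¬_)
open import Function.Bundles using (_⇔_)

-- Double Boolean algebras  (D; ⊓, ⊔, ∼, ⌟, ⊤, ⊥)  of type (2,2,1,1,0,0)
-- ∼ is the paper's ¬, ⌟ is the paper's ⌟.

record DBA (ℓ : Level) : Set (lsuc ℓ) where
  infixr 7 _⊓_
  infixr 6 _⊔ᵈ_
  field
    Carrier : Set ℓ
    _⊓_ _⊔ᵈ_ : Carrier → Carrier → Carrier
    ∼_ ⌟_ : Carrier → Carrier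
    ⊤ᵈ ⊥ᵈ : Carrier

  _∨_ : Carrier → Carrier → Carrier
  x ∨ y = ∼ ((∼ x) ⊓ (∼ y))

  _∧_ : Carrier → Carrier → Carrier
  x ∧ y = ⌟ ((⌟ x) ⊔ᵈ (⌟ y))

  field
    ax1a : ∀ x y → (x ⊓ x) ⊓ y ≡ x ⊓ y
    ax1b : ∀ x y → (x ⊔ᵈ x) ⊔ᵈ y ≡ x ⊔ᵈ y
    ax2a : ∀ x y → x ⊓ y ≡ y ⊓ x
    ax2b : ∀ x y → x ⊔ᵈ y ≡ y ⊔ᵈ x
    ax3a : ∀ x → ∼ (x ⊓ x) ≡ ∼ x
    ax3b : ∀ x → ⌟ (x ⊔ᵈ x) ≡ ⌟ x
    ax4a : ∀ x y → x ⊓ (x ⊔ᵈ y) ≡ x ⊓ x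
    ax4b : ∀ x y → x ⊔ᵈ (x ⊓ y) ≡ x ⊔ᵈ x
    ax5a : ∀ x y z → x ⊓ (y ∨ z) ≡ (x ⊓ y) ∨ (x ⊓ z)
    ax5b : ∀ x y z → x ⊔ᵈ (y ∧ z) ≡ (x ⊔ᵈ y) ∧ (x ⊔ᵈ z)
    ax6a : ∀ x y → x ⊓ (x ∨ y) ≡ x ⊓ x
    ax6b : ∀ x y → x ⊔ᵈ (x ∧ y) ≡ x ⊔ᵈ x
    ax7a : ∀ x y → ∼ (∼ (x ⊓ y)) ≡ x ⊓ y
    ax7b : ∀ x y → ⌟ (⌟ (x ⊔ᵈ y)) ≡ x ⊔ᵈ y
    ax8a : ∀ x → x ⊓ (∼ x) ≡ ⊥ᵈ
    ax8b : ∀ x → x ⊔ᵈ (⌟ x) ≡ ⊤ᵈ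
    ax9a : ∼ ⊤ᵈ ≡ ⊥ᵈ
    ax9b : ⌟ ⊥ᵈ ≡ ⊤ᵈ
    ax10a : ∀ x y z → x ⊓ (y ⊓ z) ≡ (x ⊓ y) ⊓ z
    ax10b : ∀ x y z → x ⊔ᵈ (y ⊔ᵈ z) ≡ (x ⊔ᵈ y) ⊔ᵈ z
    ax11a : ∼ ⊥ᵈ ≡ ⊤ᵈ ⊓ ⊤ᵈ
    ax11b : ⌟ ⊤ᵈ ≡ ⊥ᵈ ⊔ᵈ ⊥ᵈ
    ax12 : ∀ x → (x ⊓ x) ⊔ᵈ (x ⊓ x) ≡ (x ⊔ᵈ x) ⊓ (x ⊔ᵈ x)

  _⊑_ : Carrier → Carrier → Set ℓ
  x ⊑ y = (x ⊓ y ≡ x ⊓ x) × (x ⊔ᵈ y ≡ y ⊔ᵈ y)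

  IsFilter : Pred Carrier ℓ → Set ℓ
  IsFilter F = (∀ x y → F x → F y → F (x ⊓ y)) × (∀ x y → F x → x ⊑ y → F y)

  IsIdeal : Pred Carrier ℓ → Set ℓ
  IsIdeal I = (∀ x y → I x → I y → I (x ⊔ᵈ y)) × (∀ x y → I y → x ⊑ y → I x)

  IsPrimaryFilter : Pred Carrier ℓ → Set ℓ
  IsPrimaryFilter F =
    IsFilter F × (∃ λ x → F x) × (∃ λ x → ¬ F x) × (∀ x → F x ⊎ F (∼ x))

  IsPrimaryIdeal : Pred Carrier ℓ → Set ℓ
  IsPrimaryIdeal I =
    IsIdeal I × (∃ λ x → I x) × (∃ λ x → ¬ I x) × (∀ x → I x ⊎ I (⌟ x))

  Fpr : Set (lsuc ℓ)
  Fpr = Σ (Pred Carrier ℓ) IsPrimaryFilter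

  Ipr : Set (lsuc ℓ)
  Ipr = Σ (Pred Carrier ℓ) IsPrimaryIdeal

  Fset : Carrier → Pred Fpr ℓ
  Fset x (F , _) = F x

  Iset : Carrier → Pred Ipr ℓ
  Iset x (I , _) = I x

open DBA public using (Carrier; Fpr; Ipr; Fset; Iset)

-- Topology on a set S generated by a subbase {sb a | a : A} for the
-- CLOSED sets.  The closed sets are exactly the intersections of
-- families of finite unions of subbasic sets (the empty union is ∅,
-- the empty intersection is S).

module _ {s a ℓ : Level} {S : Set s} {A : Set a} (sb : A → Pred S ℓ) where

  FinUnion : List A → Pred S (a ⊔ ℓ)
  FinUnion as p = Any (λ b → sb b p) as

  IsClosed : ∀ {ℓ'} → Pred S ℓ' → Set (s ⊔ lsuc a ⊔ ℓ ⊔ ℓ')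
  IsClosed X =
    Σ (Set a) λ I → Σ (I → List A) λ f →
      ∀ p → X p ⇔ (∀ i → FinUnion (f i) p)

  IsOpen : ∀ {ℓ'} → Pred S ℓ' → Set (s ⊔ lsuc a ⊔ ℓ ⊔ ℓ')
  IsOpen X = IsClosed (∁ X)

  IsClopen : ∀ {ℓ'} → Pred S ℓ' → Set (s ⊔ lsuc a ⊔ ℓ ⊔ ℓ')
  IsClopen X = IsClosed X × IsOpen X

_≐_ : ∀ {s ℓ₁ ℓ₂} {S : Set s} → Pred S ℓ₁ → Pred S ℓ₂ → Set (s ⊔ ℓ₁ ⊔ ℓ₂)
X ≐ Y = ∀ p → X p ⇔ Y p

-- Classical metatheory (used as explicit hypotheses):
-- Zorn's lemma for families of subsets of a set D ordered by ⊆.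
-- Every family 𝓟 of subsets of D in which every chain (indexed by a
-- type of size ℓ, which classically suffices since there are at most
-- 2^|D| subsets up to ⊆-equivalence) has an upper bound in 𝓟 has a
-- ⊆-maximal member.

IsChain : ∀ {ℓ} {D I : Set ℓ} → (I → Pred D ℓ) → Set ℓ
IsChain C = ∀ i j → C i ⊆ C j ⊎ C j ⊆ C i

ZornSubsets : (ℓ : Level) → Set (lsuc ℓ)
ZornSubsets ℓ =
  {D : Set ℓ} (𝓟 : Pred (Pred D ℓ) ℓ) →
  ((I : Set ℓ) (C : I → Pred D ℓ) → (∀ i → 𝓟 (C i)) → IsChain C →
     Σ (Pred D ℓ) λ U → 𝓟 U × (∀ i → C i ⊆ U)) →
  Σ (Pred D ℓ) λ M → 𝓟 M × (∀ N → 𝓟 N → M ⊆ N → N ⊆ M)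

{-# OPTIONS --safe #-}
module Submission where

-- Primary filters are prime (x ∨ y ∈ F iff x ∈ F or y ∈ F), so a finite union of subbasic
-- sets F_x is the subbasic set of the join, and every closed set has the form ⋂ᵢ F_{a i}.
-- If X = ⋂ᵢ F_{a i} and its complement ⋂ⱼ F_{b j} are both closed, no primary filter contains
-- all a i and all b j. Every filter avoiding ⊥ extends, by Zorn's lemma, to a primary filter,
-- so some finite meet of the a i and b j lies below ⊥; then X = F_x for x the meet of the
-- a i occurring in it. Conversely F_x is closed with closed complement F_{∼x}. Primary
-- ideals are the primary filters of the dual algebra (⊓ ↔ ⊔, ∼ ↔ ⌟, ⊤ ↔ ⊥).

open import Defs
open import Level using (Level; lift; lower) renaming (suc to lsuc)
open import Function using (_∘_; flip; const)
open import Function.Bundles using (_⇔_; mk⇔; Equivalence)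
open import Axiom.ExcludedMiddle using (ExcludedMiddle)
open import Relation.Binary.PropositionalEquality using (_≡_; refl; sym; trans; cong; cong₂; subst; module ≡-Reasoning)
open import Relation.Unary using (Pred; _⊆_; ∁)
open import Relation.Nullary using (¬_; yes; no)
open import Relation.Nullary.Decidable using (map′; decidable-stable)
open import Data.Product using (Σ; _×_; _,_; proj₁; proj₂; ∃; uncurry)
open import Data.Sum using (_⊎_; inj₁; inj₂; [_,_])
open import Data.Empty using (⊥-elim)
open import Data.Maybe using (Maybe; just; nothing)
open import Data.Unit.Polymorphic using (⊤; tt)
open import Data.List using (List; []; _∷_; _++_)
open import Data.List.Relation.Unary.Any as Any using (Any)
open import Data.List.Relation.Unary.All as All using (All; []; _∷_)
open import Data.List.Relation.Unary.Any.Properties using (singleton⁻)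
open import Function.Related.TypeIsomorphisms using (¬-cong-⇔)
open import Function.Properties.Equivalence using () renaming (refl to ⇔-refl; trans to ⇔-trans)
open import Data.Sum.Function.Propositional using (_⊎-⇔_)
open import Data.Product.Function.NonDependent.Propositional using (_×-⇔_)

module Laws {ℓ : Level} (𝐃 : DBA ℓ) where
  open DBA 𝐃 renaming (Carrier to D)
  open ≡-Reasoning

  ⊓-idem : ∀ x y → (x ⊓ y) ⊓ (x ⊓ y) ≡ x ⊓ y
  ⊓-idem x y = begin
    (x ⊓ y) ⊓ (x ⊓ y)         ≡⟨ sym (ax7a (x ⊓ y) (x ⊓ y)) ⟩
    ∼ (∼ ((x ⊓ y) ⊓ (x ⊓ y))) ≡⟨ cong ∼_ (ax3a (x ⊓ y)) ⟩
    ∼ (∼ (x ⊓ y))             ≡⟨ ax7a x y ⟩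
    x ⊓ y                     ∎

  x⊓⊤≡x⊓x : ∀ x → x ⊓ ⊤ᵈ ≡ x ⊓ x
  x⊓⊤≡x⊓x x = trans (cong (x ⊓_) (sym (ax8b x))) (ax4a x (⌟ x))

  x⊔⊥≡x⊔x : ∀ x → x ⊔ᵈ ⊥ᵈ ≡ x ⊔ᵈ x
  x⊔⊥≡x⊔x x = trans (cong (x ⊔ᵈ_) (sym (ax8a x))) (ax4b x (∼ x))

  x⊓⊥≡⊥ : ∀ x → x ⊓ ⊥ᵈ ≡ ⊥ᵈ
  x⊓⊥≡⊥ x = begin
    x ⊓ ⊥ᵈ          ≡⟨ cong (x ⊓_) (sym (ax8a x)) ⟩
    x ⊓ (x ⊓ ∼ x)   ≡⟨ ax10a x x (∼ x) ⟩
    (x ⊓ x) ⊓ ∼ x   ≡⟨ ax1a x (∼ x) ⟩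
    x ⊓ ∼ x         ≡⟨ ax8a x ⟩
    ⊥ᵈ              ∎

  x⊔⊤≡⊤ : ∀ x → x ⊔ᵈ ⊤ᵈ ≡ ⊤ᵈ
  x⊔⊤≡⊤ x = begin
    x ⊔ᵈ ⊤ᵈ           ≡⟨ cong (x ⊔ᵈ_) (sym (ax8b x)) ⟩
    x ⊔ᵈ (x ⊔ᵈ ⌟ x)   ≡⟨ ax10b x x (⌟ x) ⟩
    (x ⊔ᵈ x) ⊔ᵈ ⌟ x   ≡⟨ ax1b x (⌟ x) ⟩
    x ⊔ᵈ ⌟ x          ≡⟨ ax8b x ⟩
    ⊤ᵈ                ∎

  x⊓[⊤⊓⊤]≡x⊓x : ∀ x → x ⊓ (⊤ᵈ ⊓ ⊤ᵈ) ≡ x ⊓ x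
  x⊓[⊤⊓⊤]≡x⊓x x = begin
    x ⊓ (⊤ᵈ ⊓ ⊤ᵈ)   ≡⟨ ax10a x ⊤ᵈ ⊤ᵈ ⟩
    (x ⊓ ⊤ᵈ) ⊓ ⊤ᵈ   ≡⟨ cong (_⊓ ⊤ᵈ) (x⊓⊤≡x⊓x x) ⟩
    (x ⊓ x) ⊓ ⊤ᵈ    ≡⟨ ax1a x ⊤ᵈ ⟩
    x ⊓ ⊤ᵈ          ≡⟨ x⊓⊤≡x⊓x x ⟩
    x ⊓ x           ∎

  x∨∼x≡⊤⊓⊤ : ∀ x → x ∨ (∼ x) ≡ ⊤ᵈ ⊓ ⊤ᵈ
  x∨∼x≡⊤⊓⊤ x = trans (cong ∼_ (ax8a (∼ x))) ax11a

  ⊥∨⊥≡⊥ : ⊥ᵈ ∨ ⊥ᵈ ≡ ⊥ᵈ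
  ⊥∨⊥≡⊥ = begin
    ∼ (∼ ⊥ᵈ ⊓ ∼ ⊥ᵈ)               ≡⟨ cong (λ t → ∼ (t ⊓ t)) ax11a ⟩
    ∼ ((⊤ᵈ ⊓ ⊤ᵈ) ⊓ (⊤ᵈ ⊓ ⊤ᵈ))     ≡⟨ cong ∼_ (⊓-idem ⊤ᵈ ⊤ᵈ) ⟩
    ∼ (⊤ᵈ ⊓ ⊤ᵈ)                   ≡⟨ ax3a ⊤ᵈ ⟩
    ∼ ⊤ᵈ                          ≡⟨ ax9a ⟩
    ⊥ᵈ                            ∎

  ⊓≡⊥-by-cases : ∀ x y → x ⊓ y ≡ ⊥ᵈ → x ⊓ ∼ y ≡ ⊥ᵈ → x ⊓ x ≡ ⊥ᵈ
  ⊓≡⊥-by-cases x y x⊓y≡⊥ x⊓∼y≡⊥ = begin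
    x ⊓ x                   ≡⟨ sym (x⊓[⊤⊓⊤]≡x⊓x x) ⟩
    x ⊓ (⊤ᵈ ⊓ ⊤ᵈ)           ≡⟨ cong (x ⊓_) (sym (x∨∼x≡⊤⊓⊤ y))  ⟩
    x ⊓ (y ∨ (∼ y))          ≡⟨ ax5a x y (∼ y) ⟩
    (x ⊓ y) ∨ (x ⊓ ∼ y)     ≡⟨ cong₂ _∨_ x⊓y≡⊥ x⊓∼y≡⊥ ⟩
    ⊥ᵈ ∨ ⊥ᵈ                 ≡⟨ ⊥∨⊥≡⊥ ⟩
    ⊥ᵈ                      ∎

  ⊑-refl : ∀ {x} → x ⊑ x
  ⊑-refl = refl , refl

  ⊑-reflexive : ∀ {x y} → x ≡ y → x ⊑ y
  ⊑-reflexive refl = ⊑-refl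

  ⊑-trans : ∀ {x y z} → x ⊑ y → y ⊑ z → x ⊑ z
  ⊑-trans {x} {y} {z} (x⊓y , x⊔y) (y⊓z , y⊔z) = ⊓-part , ⊔-part
    where
    ⊓-part : x ⊓ z ≡ x ⊓ x
    ⊓-part = begin
      x ⊓ z         ≡⟨ sym (ax1a x z) ⟩
      (x ⊓ x) ⊓ z   ≡⟨ cong (_⊓ z) (sym x⊓y) ⟩
      (x ⊓ y) ⊓ z   ≡⟨ sym (ax10a x y z) ⟩
      x ⊓ (y ⊓ z)   ≡⟨ cong (x ⊓_) y⊓z ⟩
      x ⊓ (y ⊓ y)   ≡⟨ ax10a x y y ⟩
      (x ⊓ y) ⊓ y   ≡⟨ cong (_⊓ y) x⊓y ⟩
      (x ⊓ x) ⊓ y   ≡⟨ ax1a x y ⟩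
      x ⊓ y         ≡⟨ x⊓y ⟩
      x ⊓ x         ∎
    ⊔-part : x ⊔ᵈ z ≡ z ⊔ᵈ z
    ⊔-part = begin
      x ⊔ᵈ z           ≡⟨ ax2b x z ⟩
      z ⊔ᵈ x           ≡⟨ sym (ax1b z x) ⟩
      (z ⊔ᵈ z) ⊔ᵈ x    ≡⟨ cong (_⊔ᵈ x) (sym y⊔z) ⟩
      (y ⊔ᵈ z) ⊔ᵈ x    ≡⟨ ax2b (y ⊔ᵈ z) x ⟩
      x ⊔ᵈ (y ⊔ᵈ z)    ≡⟨ ax10b x y z ⟩
      (x ⊔ᵈ y) ⊔ᵈ z    ≡⟨ cong (_⊔ᵈ z) x⊔y ⟩
      (y ⊔ᵈ y) ⊔ᵈ z    ≡⟨ ax1b y z ⟩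
      y ⊔ᵈ z           ≡⟨ y⊔z ⟩
      z ⊔ᵈ z           ∎

  -- The ⊔-half of x ⊑ y follows from the ⊓-half by absorption.
  ⊓≡⇒⊑ : ∀ {x y} → x ⊓ x ≡ x → x ⊓ y ≡ x → x ⊑ y
  ⊓≡⇒⊑ {x} {y} x⊓x≡x x⊓y≡x = trans x⊓y≡x (sym x⊓x≡x) , (begin
    x ⊔ᵈ y          ≡⟨ cong (_⊔ᵈ y) (sym x⊓y≡x) ⟩
    (x ⊓ y) ⊔ᵈ y    ≡⟨ ax2b (x ⊓ y) y ⟩
    y ⊔ᵈ (x ⊓ y)    ≡⟨ cong (y ⊔ᵈ_) (ax2a x y) ⟩
    y ⊔ᵈ (y ⊓ x)    ≡⟨ ax4b y x ⟩
    y ⊔ᵈ y          ∎)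

  x⊓y⊑x : ∀ x y → (x ⊓ y) ⊑ x
  x⊓y⊑x x y = ⊓≡⇒⊑ (⊓-idem x y) (begin
    (x ⊓ y) ⊓ x   ≡⟨ ax2a (x ⊓ y) x ⟩
    x ⊓ (x ⊓ y)   ≡⟨ ax10a x x y ⟩
    (x ⊓ x) ⊓ y   ≡⟨ ax1a x y ⟩
    x ⊓ y         ∎)

  x⊓y⊑y : ∀ x y → (x ⊓ y) ⊑ y
  x⊓y⊑y x y = subst (_⊑ y) (ax2a y x) (x⊓y⊑x y x)

  ⊓-mono-⊑ : ∀ {x y u v} → x ⊑ u → y ⊑ v → (x ⊓ y) ⊑ (u ⊓ v)
  ⊓-mono-⊑ {x} {y} {u} {v} (x⊓u , _) (y⊓v , _) = ⊓≡⇒⊑ (⊓-idem x y) (begin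
    (x ⊓ y) ⊓ (u ⊓ v)   ≡⟨ sym (ax10a x y (u ⊓ v)) ⟩
    x ⊓ (y ⊓ (u ⊓ v))   ≡⟨ cong (x ⊓_) (ax10a y u v) ⟩
    x ⊓ ((y ⊓ u) ⊓ v)   ≡⟨ cong (λ t → x ⊓ (t ⊓ v)) (ax2a y u) ⟩
    x ⊓ ((u ⊓ y) ⊓ v)   ≡⟨ cong (x ⊓_) (sym (ax10a u y v)) ⟩
    x ⊓ (u ⊓ (y ⊓ v))   ≡⟨ ax10a x u (y ⊓ v) ⟩
    (x ⊓ u) ⊓ (y ⊓ v)   ≡⟨ cong₂ _⊓_ x⊓u y⊓v ⟩
    (x ⊓ x) ⊓ (y ⊓ y)   ≡⟨ ax1a x (y ⊓ y) ⟩
    x ⊓ (y ⊓ y)         ≡⟨ ax2a x (y ⊓ y) ⟩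
    (y ⊓ y) ⊓ x         ≡⟨ ax1a y x ⟩
    y ⊓ x               ≡⟨ ax2a y x ⟩
    x ⊓ y               ∎)

  ⊓-glb : ∀ {x u v} → x ⊓ x ≡ x → x ⊑ u → x ⊑ v → x ⊑ (u ⊓ v)
  ⊓-glb x⊓x≡x x⊑u x⊑v = ⊑-trans (⊑-reflexive (sym x⊓x≡x)) (⊓-mono-⊑ x⊑u x⊑v)

  ⊥⊑x : ∀ x → ⊥ᵈ ⊑ x
  ⊥⊑x x = trans (trans (ax2a ⊥ᵈ x) (x⊓⊥≡⊥ x)) (sym (x⊓⊥≡⊥ ⊥ᵈ)) ,
          trans (ax2b ⊥ᵈ x) (x⊔⊥≡x⊔x x)

  x⊑⊤ : ∀ x → x ⊑ ⊤ᵈ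
  x⊑⊤ x = x⊓⊤≡x⊓x x , trans (x⊔⊤≡⊤ x) (sym (x⊔⊤≡⊤ ⊤ᵈ))

  x⊓y⊑⊥⇒x⊓y≡⊥ : ∀ x y → (x ⊓ y) ⊑ ⊥ᵈ → x ⊓ y ≡ ⊥ᵈ
  x⊓y⊑⊥⇒x⊓y≡⊥ x y (x⊓y⊓⊥ , _) =
    trans (sym (⊓-idem x y)) (trans (sym x⊓y⊓⊥) (x⊓⊥≡⊥ (x ⊓ y)))

  -- The empty meet is ⊤ ⊓ ⊤ rather than ⊤ so that every finite meet is ⊓-idempotent.
  ⋀ : ∀ {k} {K : Set k} → (K → D) → List K → D
  ⋀ h []       = ⊤ᵈ ⊓ ⊤ᵈ
  ⋀ h (k ∷ ks) = h k ⊓ ⋀ h ks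

  ⋀-idem : ∀ {k} {K : Set k} (h : K → D) ks → ⋀ h ks ⊓ ⋀ h ks ≡ ⋀ h ks
  ⋀-idem h []       = ⊓-idem ⊤ᵈ ⊤ᵈ
  ⋀-idem h (k ∷ ks) = ⊓-idem (h k) (⋀ h ks)

  ⋀-++ : ∀ {k} {K : Set k} (h : K → D) ks ls → ⋀ h (ks ++ ls) ⊑ (⋀ h ks ⊓ ⋀ h ls)
  ⋀-++ h []       ls = ⊓-glb (⋀-idem h ls) (⊓-glb (⋀-idem h ls) (x⊑⊤ _) (x⊑⊤ _)) ⊑-refl
  ⋀-++ h (k ∷ ks) ls = ⊑-trans (⊓-mono-⊑ ⊑-refl (⋀-++ h ks ls))
                               (⊑-reflexive (ax10a (h k) (⋀ h ks) (⋀ h ls)))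

  ⋁ : List D → D
  ⋁ []       = ⊥ᵈ
  ⋁ (x ∷ xs) = x ∨ ⋁ xs

module Filters {ℓ : Level} (𝐃 : DBA ℓ) where
  open DBA 𝐃 renaming (Carrier to D)
  open Laws 𝐃

  module PrimaryFilter {F : Pred D ℓ} (F-primary : IsPrimaryFilter F) where
    ⊓-closed : ∀ {x y} → F x → F y → F (x ⊓ y)
    ⊓-closed = proj₁ (proj₁ F-primary) _ _

    up-closed : ∀ {x y} → F x → x ⊑ y → F y
    up-closed = proj₂ (proj₁ F-primary) _ _

    ∈-or-∼∈ : ∀ x → F x ⊎ F (∼ x)
    ∈-or-∼∈ = proj₂ (proj₂ (proj₂ F-primary))

    ∋⊤ : F ⊤ᵈ
    ∋⊤ with proj₁ (proj₂ F-primary)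
    ... | x , x∈F = up-closed x∈F (x⊑⊤ x)

    ∌⊥ : ¬ F ⊥ᵈ
    ∌⊥ ⊥∈F with proj₁ (proj₂ (proj₂ F-primary))
    ... | x , x∉F = x∉F (up-closed ⊥∈F (⊥⊑x x))

    ∼-disjoint : ∀ {x} → F x → ¬ F (∼ x)
    ∼-disjoint {x} x∈F ∼x∈F = ∌⊥ (subst F (ax8a x) (⊓-closed x∈F ∼x∈F))

    ⊓⇔× : ∀ {x y} → F (x ⊓ y) ⇔ (F x × F y)
    ⊓⇔× {x} {y} = mk⇔ (λ x⊓y∈F → up-closed x⊓y∈F (x⊓y⊑x x y) , up-closed x⊓y∈F (x⊓y⊑y x y))
                      (λ (x∈F , y∈F) → ⊓-closed x∈F y∈F)

    ∨⇔⊎ : ∀ {x y} → F (x ∨ y) ⇔ (F x ⊎ F y)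
    ∨⇔⊎ {x} {y} = mk⇔ to from
      where
      to : F (x ∨ y) → F x ⊎ F y
      to x∨y∈F with ∈-or-∼∈ x | ∈-or-∼∈ y
      ... | inj₁ x∈F | _        = inj₁ x∈F
      ... | inj₂ _   | inj₁ y∈F = inj₂ y∈F
      ... | inj₂ ∼x∈F | inj₂ ∼y∈F = ⊥-elim (∼-disjoint (⊓-closed ∼x∈F ∼y∈F) x∨y∈F)
      from : F x ⊎ F y → F (x ∨ y)
      from x∈F⊎y∈F with ∈-or-∼∈ (∼ x ⊓ ∼ y)
      ... | inj₂ x∨y∈F = x∨y∈F
      ... | inj₁ ∼x⊓∼y∈F with x∈F⊎y∈F | Equivalence.to ⊓⇔× ∼x⊓∼y∈F
      ...   | inj₁ x∈F | ∼x∈F , _ = ⊥-elim (∼-disjoint x∈F ∼x∈F)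
      ...   | inj₂ y∈F | _ , ∼y∈F = ⊥-elim (∼-disjoint y∈F ∼y∈F)

    ⋀⇔All : ∀ {k} {K : Set k} (h : K → D) ks → F (⋀ h ks) ⇔ All (F ∘ h) ks
    ⋀⇔All h []       = mk⇔ (λ _ → []) (λ _ → ⊓-closed ∋⊤ ∋⊤)
    ⋀⇔All h (k ∷ ks) =
      ⇔-trans ⊓⇔× (⇔-trans (⇔-refl ×-⇔ ⋀⇔All h ks) (mk⇔ (uncurry _∷_) All.uncons))

    ⋁⇔Any : ∀ xs → F (⋁ xs) ⇔ Any F xs
    ⋁⇔Any []       = mk⇔ (⊥-elim ∘ ∌⊥) (λ ())
    ⋁⇔Any (x ∷ xs) =
      ⇔-trans ∨⇔⊎ (⇔-trans (⇔-refl ⊎-⇔ ⋁⇔Any xs) (mk⇔ Any.fromSum Any.toSum))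

  generated : {K : Set ℓ} → (K → D) → Pred D ℓ
  generated e y = ∃ λ ks → ⋀ e ks ⊑ y

  module _ {K : Set ℓ} (e : K → D) where
    generated-isFilter : IsFilter (generated e)
    generated-isFilter =
      (λ { _ _ (ks , ⋀ks⊑x) (ls , ⋀ls⊑y) →
             ks ++ ls , ⊑-trans (⋀-++ e ks ls) (⊓-mono-⊑ ⋀ks⊑x ⋀ls⊑y) }) ,
      (λ { _ _ (ks , ⋀ks⊑x) x⊑y → ks , ⊑-trans ⋀ks⊑x x⊑y })

    generated-∋⊤ : generated e ⊤ᵈ
    generated-∋⊤ = [] , x⊑⊤ (⋀ e [])

    generated-∋ : ∀ k → generated e (e k)
    generated-∋ k = k ∷ [] , x⊓y⊑x (e k) (⋀ e [])

  adjoin : Pred D ℓ → D → Pred D ℓ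
  adjoin F x y = ∃ λ m → F m × (m ⊓ x) ⊑ y

  module _ {F : Pred D ℓ} (F-filter : IsFilter F) (x : D) where
    adjoin-isFilter : IsFilter (adjoin F x)
    adjoin-isFilter =
      (λ { _ _ (m , m∈F , m⊓x⊑y) (n , n∈F , n⊓x⊑z) →
             m ⊓ n , proj₁ F-filter m n m∈F n∈F ,
             ⊓-glb (⊓-idem (m ⊓ n) x)
                   (⊑-trans (⊓-mono-⊑ (x⊓y⊑x m n) ⊑-refl) m⊓x⊑y)
                   (⊑-trans (⊓-mono-⊑ (x⊓y⊑y m n) ⊑-refl) n⊓x⊑z) }) ,
      (λ { _ _ (m , m∈F , m⊓x⊑y) y⊑z → m , m∈F , ⊑-trans m⊓x⊑y y⊑z })

    ⊆-adjoin : F ⊆ adjoin F x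
    ⊆-adjoin {y} y∈F = y , y∈F , x⊓y⊑x y x

    adjoin-∋ : F ⊤ᵈ → adjoin F x x
    adjoin-∋ ⊤∈F = ⊤ᵈ , ⊤∈F , x⊓y⊑y ⊤ᵈ x

  ⋃-chain-isFilter : {I : Set ℓ} (C : I → Pred D ℓ) → (∀ i → IsFilter (C i)) → IsChain C →
                     IsFilter (λ y → ∃ λ i → C i y)
  ⋃-chain-isFilter C C-filter C-chain =
    (λ { x y (i , x∈Ci) (j , y∈Cj) → meet-in-larger x y i j x∈Ci y∈Cj (C-chain i j) }) ,
    (λ { x y (i , x∈Ci) x⊑y → i , proj₂ (C-filter i) x y x∈Ci x⊑y })
    where
    meet-in-larger : ∀ x y i j → C i x → C j y → C i ⊆ C j ⊎ C j ⊆ C i → ∃ λ k → C k (x ⊓ y)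
    meet-in-larger x y i j x∈Ci y∈Cj (inj₁ Ci⊆Cj) = j , proj₁ (C-filter j) x y (Ci⊆Cj x∈Ci) y∈Cj
    meet-in-larger x y i j x∈Ci y∈Cj (inj₂ Cj⊆Ci) = i , proj₁ (C-filter i) x y x∈Ci (Cj⊆Ci y∈Cj)

module PrimeFilterTheorem {ℓ : Level} (em : ExcludedMiddle (lsuc ℓ)) (zorn : ZornSubsets ℓ)
                          (𝐃 : DBA ℓ) where
  open DBA 𝐃 renaming (Carrier to D)
  open Laws 𝐃
  open Filters 𝐃

  em-lower : ExcludedMiddle ℓ
  em-lower = map′ lower lift em

  module _ {G : Pred D ℓ} (G-filter : IsFilter G) (G∋⊤ : G ⊤ᵈ) (G∌⊥ : ¬ G ⊥ᵈ) where
    ProperFilterAbove : Pred (Pred D ℓ) ℓ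
    ProperFilterAbove N = IsFilter N × ¬ N ⊥ᵈ × G ⊆ N

    -- The chain is extended by G at index nothing so that an empty chain is bounded too.
    chain-bounded : (I : Set ℓ) (C : I → Pred D ℓ) → (∀ i → ProperFilterAbove (C i)) → IsChain C →
                    Σ (Pred D ℓ) λ U → ProperFilterAbove U × (∀ i → C i ⊆ U)
    chain-bounded I C C-proper C-chain =
      U , (⋃-chain-isFilter C′ C′-filter C′-chain , U∌⊥ , (λ y∈G → nothing , y∈G)) ,
      (λ i y∈Ci → just i , y∈Ci)
      where
      C′ : Maybe I → Pred D ℓ
      C′ nothing  = G
      C′ (just i) = C i
      U : Pred D ℓ
      U y = ∃ λ i → C′ i y
      C′-filter : ∀ i → IsFilter (C′ i)
      C′-filter nothing  = G-filter
      C′-filter (just i) = proj₁ (C-proper i)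
      C′-chain : IsChain C′
      C′-chain nothing  nothing  = inj₁ (λ y∈G → y∈G)
      C′-chain nothing  (just j) = inj₁ (proj₂ (proj₂ (C-proper j)))
      C′-chain (just i) nothing  = inj₂ (proj₂ (proj₂ (C-proper i)))
      C′-chain (just i) (just j) = C-chain i j
      U∌⊥ : ¬ U ⊥ᵈ
      U∌⊥ (nothing , ⊥∈G)  = G∌⊥ ⊥∈G
      U∌⊥ (just i , ⊥∈Ci) = proj₁ (proj₂ (C-proper i)) ⊥∈Ci

    private
      maximal : Σ (Pred D ℓ) λ M → ProperFilterAbove M × (∀ N → ProperFilterAbove N → M ⊆ N → N ⊆ M)
      maximal = zorn ProperFilterAbove chain-bounded

      M : Pred D ℓ
      M = proj₁ maximal

      M-filter : IsFilter M
      M-filter = proj₁ (proj₁ (proj₂ maximal))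

      M∌⊥ : ¬ M ⊥ᵈ
      M∌⊥ = proj₁ (proj₂ (proj₁ (proj₂ maximal)))

      G⊆M : G ⊆ M
      G⊆M = proj₂ (proj₂ (proj₁ (proj₂ maximal)))

      M-maximal : ∀ N → ProperFilterAbove N → M ⊆ N → N ⊆ M
      M-maximal = proj₂ (proj₂ maximal)

      M-⊓ : ∀ {x y} → M x → M y → M (x ⊓ y)
      M-⊓ = proj₁ M-filter _ _

    ∉M⇒adjoin∋⊥ : ∀ {x} → ¬ M x → adjoin M x ⊥ᵈ
    ∉M⇒adjoin∋⊥ {x} x∉M = decidable-stable em-lower λ ⊥∉adjoin →
      x∉M (M-maximal (adjoin M x)
                     (adjoin-isFilter M-filter x , ⊥∉adjoin , ⊆-adjoin M-filter x ∘ G⊆M)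
                     (⊆-adjoin M-filter x)
                     (adjoin-∋ M-filter x (G⊆M G∋⊤)))

    adjoin∋⊥⇒adjoin-∼∌⊥ : ∀ {x} → adjoin M x ⊥ᵈ → ¬ adjoin M (∼ x) ⊥ᵈ
    adjoin∋⊥⇒adjoin-∼∌⊥ {x} (m , m∈M , m⊓x⊑⊥) (n , n∈M , n⊓∼x⊑⊥) =
      M∌⊥ (subst M mn⊓mn≡⊥ (M-⊓ (M-⊓ m∈M n∈M) (M-⊓ m∈M n∈M)))
      where
      mn⊓mn≡⊥ : (m ⊓ n) ⊓ (m ⊓ n) ≡ ⊥ᵈ
      mn⊓mn≡⊥ = ⊓≡⊥-by-cases (m ⊓ n) x
        (x⊓y⊑⊥⇒x⊓y≡⊥ (m ⊓ n) x (⊑-trans (⊓-mono-⊑ (x⊓y⊑x m n) ⊑-refl) m⊓x⊑⊥))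
        (x⊓y⊑⊥⇒x⊓y≡⊥ (m ⊓ n) (∼ x) (⊑-trans (⊓-mono-⊑ (x⊓y⊑y m n) ⊑-refl) n⊓∼x⊑⊥))

    M-∈-or-∼∈ : ∀ x → M x ⊎ M (∼ x)
    M-∈-or-∼∈ x with em-lower {M x} | em-lower {M (∼ x)}
    ... | yes x∈M | _        = inj₁ x∈M
    ... | no _    | yes ∼x∈M = inj₂ ∼x∈M
    ... | no x∉M  | no ∼x∉M  = ⊥-elim (adjoin∋⊥⇒adjoin-∼∌⊥ (∉M⇒adjoin∋⊥ x∉M) (∉M⇒adjoin∋⊥ ∼x∉M))

    primary-extension : Σ (Pred D ℓ) λ F → IsPrimaryFilter F × G ⊆ F
    primary-extension = M , (M-filter , (⊤ᵈ , G⊆M G∋⊤) , (⊥ᵈ , M∌⊥) , M-∈-or-∼∈) , G⊆M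

  compactness : {K : Set ℓ} (e : K → D) →
                (∀ F → IsPrimaryFilter F → ¬ (∀ k → F (e k))) →
                ∃ λ ks → ∀ F → IsPrimaryFilter F → ¬ All (F ∘ e) ks
  compactness e no-F-∋-all with em-lower {∃ λ ks → ⋀ e ks ⊑ ⊥ᵈ}
  ... | yes (ks , ⋀ks⊑⊥) = ks , λ F F-primary all →
        let open PrimaryFilter F-primary in ∌⊥ (up-closed (Equivalence.from (⋀⇔All e ks) all) ⋀ks⊑⊥)
  ... | no ⊥∉generated with primary-extension (generated-isFilter e) (generated-∋⊤ e) ⊥∉generated
  ...   | F , F-primary , generated⊆F = ⊥-elim (no-F-∋-all F F-primary (generated⊆F ∘ generated-∋ e))

-- Points are parametrised by any predicate equivalent to IsPrimaryFilter, because primary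
-- ideals are primary filters of the dual algebra only up to logical equivalence.
module ClopenSets {ℓ : Level} (em : ExcludedMiddle (lsuc ℓ)) (zorn : ZornSubsets ℓ) (𝐃 : DBA ℓ)
                  (IsPoint : Pred (Pred (Carrier 𝐃) ℓ) ℓ)
                  (IsPoint⇔IsPrimaryFilter : ∀ {F} → IsPoint F ⇔ DBA.IsPrimaryFilter 𝐃 F) where
  open DBA 𝐃 renaming (Carrier to D)
  open Laws 𝐃 using (⋀; ⋁)
  open Filters 𝐃
  open PrimeFilterTheorem em zorn 𝐃

  Point : Set (lsuc ℓ)
  Point = Σ (Pred D ℓ) IsPoint

  ⟦_⟧ : D → Pred Point ℓ
  ⟦ x ⟧ (F , _) = F x

  isPrimary : (p : Point) → IsPrimaryFilter (proj₁ p)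
  isPrimary p = Equivalence.to IsPoint⇔IsPrimaryFilter (proj₂ p)

  module Point (p : Point) = PrimaryFilter (isPrimary p)

  ∁⟦x⟧≐⟦∼x⟧ : ∀ x → ∁ ⟦ x ⟧ ≐ ⟦ ∼ x ⟧
  ∁⟦x⟧≐⟦∼x⟧ x p = mk⇔ x∉p⇒∼x∈p (flip (Point.∼-disjoint p))
    where
    x∉p⇒∼x∈p : ¬ ⟦ x ⟧ p → ⟦ ∼ x ⟧ p
    x∉p⇒∼x∈p x∉p with Point.∈-or-∼∈ p x
    ... | inj₁ x∈p  = ⊥-elim (x∉p x∈p)
    ... | inj₂ ∼x∈p = ∼x∈p

  ≐subbasic⇒isClosed : ∀ {ℓ′} {X : Pred Point ℓ′} x → X ≐ ⟦ x ⟧ → IsClosed ⟦_⟧ X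
  ≐subbasic⇒isClosed x X≐⟦x⟧ = ⊤ , (λ _ → x ∷ []) , λ p →
    mk⇔ (λ x∈X _ → Any.here (Equivalence.to (X≐⟦x⟧ p) x∈X))
        (λ x∈⋂ → Equivalence.from (X≐⟦x⟧ p) (singleton⁻ (x∈⋂ tt)))

  ≐subbasic⇒isClopen : ∀ {ℓ′} {X : Pred Point ℓ′} x → X ≐ ⟦ x ⟧ → IsClopen ⟦_⟧ X
  ≐subbasic⇒isClopen {X = X} x X≐⟦x⟧ =
    ≐subbasic⇒isClosed x X≐⟦x⟧ ,
    ≐subbasic⇒isClosed (∼ x) λ p → ⇔-trans (¬-cong-⇔ (X≐⟦x⟧ p)) (∁⟦x⟧≐⟦∼x⟧ x p)

  isClosed⇒⋂subbasic : ∀ {ℓ′} {X : Pred Point ℓ′} → IsClosed ⟦_⟧ X →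
                       Σ (Set ℓ) λ I → Σ (I → D) λ a → ∀ p → X p ⇔ (∀ i → ⟦ a i ⟧ p)
  isClosed⇒⋂subbasic (I , f , X≐⋂) = I , ⋁ ∘ f , λ p → ⇔-trans (X≐⋂ p)
    (mk⇔ (λ ∈⋃ i → Equivalence.from (Point.⋁⇔Any p (f i)) (∈⋃ i))
         (λ ∈⋁ i → Equivalence.to (Point.⋁⇔Any p (f i)) (∈⋁ i)))

  ⋂subbasic-and-complement⇒subbasic :
    {X : Pred Point (lsuc ℓ)} {I J : Set ℓ} (a : I → D) (b : J → D) →
    (∀ p → X p ⇔ (∀ i → ⟦ a i ⟧ p)) → (∀ p → ∁ X p ⇔ (∀ j → ⟦ b j ⟧ p)) →
    ∃ λ x → X ≐ ⟦ x ⟧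
  ⋂subbasic-and-complement⇒subbasic {X} {I} {J} a b X≐⋂a ∁X≐⋂b = ⋀ a′ ks , λ p → mk⇔ (X⇒⋀ p) (⋀⇒X p)
    where
    e : I ⊎ J → D
    e = [ a , b ]

    no-primary-∋-all : ∀ F → IsPrimaryFilter F → ¬ (∀ k → F (e k))
    no-primary-∋-all F F-primary F∋e =
      Equivalence.from (∁X≐⋂b p) (F∋e ∘ inj₂) (Equivalence.from (X≐⋂a p) (F∋e ∘ inj₁))
      where
      p : Point
      p = F , Equivalence.from IsPoint⇔IsPrimaryFilter F-primary

    ks : List (I ⊎ J)
    ks = proj₁ (compactness e no-primary-∋-all)

    -- Replacing b by ⊤ is harmless off X, where every b j holds anyway.
    a′ : I ⊎ J → D
    a′ = [ a , const ⊤ᵈ ]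

    X⇒⋀ : ∀ p → X p → ⟦ ⋀ a′ ks ⟧ p
    X⇒⋀ p p∈X = Equivalence.from (Point.⋀⇔All p a′ ks) (All.tabulate λ {k} _ → a′∈p k)
      where
      a′∈p : ∀ k → ⟦ a′ k ⟧ p
      a′∈p (inj₁ i) = Equivalence.to (X≐⋂a p) p∈X i
      a′∈p (inj₂ _) = Point.∋⊤ p

    ⋀⇒X : ∀ p → ⟦ ⋀ a′ ks ⟧ p → X p
    ⋀⇒X p ⋀∈p = decidable-stable em λ p∉X →
      proj₂ (compactness e no-primary-∋-all) (proj₁ p) (isPrimary p)
            (All.map (λ {k} → a′⇒e p∉X k) (Equivalence.to (Point.⋀⇔All p a′ ks) ⋀∈p))
      where
      a′⇒e : ¬ X p → ∀ k → ⟦ a′ k ⟧ p → ⟦ e k ⟧ p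
      a′⇒e _   (inj₁ _) a∈p = a∈p
      a′⇒e p∉X (inj₂ j) _   = Equivalence.to (∁X≐⋂b p) p∉X j

  isClopen⇔≐subbasic : (X : Pred Point (lsuc ℓ)) → IsClopen ⟦_⟧ X ⇔ (∃ λ x → X ≐ ⟦ x ⟧)
  isClopen⇔≐subbasic X = mk⇔ isClopen⇒≐subbasic (λ (x , X≐⟦x⟧) → ≐subbasic⇒isClopen x X≐⟦x⟧)
    where
    isClopen⇒≐subbasic : IsClopen ⟦_⟧ X → ∃ λ x → X ≐ ⟦ x ⟧
    isClopen⇒≐subbasic (X-closed , X-open)
      with isClosed⇒⋂subbasic X-closed | isClosed⇒⋂subbasic X-open
    ... | _ , a , X≐⋂a | _ , b , ∁X≐⋂b = ⋂subbasic-and-complement⇒subbasic a b X≐⋂a ∁X≐⋂b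

dual : ∀ {ℓ} → DBA ℓ → DBA ℓ
dual 𝐃 = record
  { Carrier = Carrier 𝐃
  ; _⊓_ = _⊔ᵈ_ ; _⊔ᵈ_ = _⊓_ ; ∼_ = ⌟_ ; ⌟_ = ∼_ ; ⊤ᵈ = ⊥ᵈ ; ⊥ᵈ = ⊤ᵈ
  ; ax1a = ax1b ; ax1b = ax1a ; ax2a = ax2b ; ax2b = ax2a
  ; ax3a = ax3b ; ax3b = ax3a ; ax4a = ax4b ; ax4b = ax4a
  ; ax5a = ax5b ; ax5b = ax5a ; ax6a = ax6b ; ax6b = ax6a
  ; ax7a = ax7b ; ax7b = ax7a ; ax8a = ax8b ; ax8b = ax8a
  ; ax9a = ax9b ; ax9b = ax9a ; ax10a = ax10b ; ax10b = ax10a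
  ; ax11a = ax11b ; ax11b = ax11a ; ax12 = λ x → sym (ax12 x)
  }
  where open DBA 𝐃 hiding (Carrier)

module Duality {ℓ : Level} (𝐃 : DBA ℓ) where
  open DBA 𝐃
  private module 𝐃ᵒᵖ = DBA (dual 𝐃)

  ⊑⇒⊒ᵒᵖ : ∀ {x y} → x ⊑ y → y 𝐃ᵒᵖ.⊑ x
  ⊑⇒⊒ᵒᵖ {x} {y} (x⊓y , x⊔y) = trans (ax2b y x) x⊔y , trans (ax2a y x) x⊓y

  ⊒ᵒᵖ⇒⊑ : ∀ {x y} → y 𝐃ᵒᵖ.⊑ x → x ⊑ y
  ⊒ᵒᵖ⇒⊑ {x} {y} (y⊔x , y⊓x) = trans (ax2a x y) y⊓x , trans (ax2b x y) y⊔x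

  isPrimaryIdeal⇔isPrimaryFilterᵒᵖ : ∀ {I} → IsPrimaryIdeal I ⇔ 𝐃ᵒᵖ.IsPrimaryFilter I
  isPrimaryIdeal⇔isPrimaryFilterᵒᵖ = mk⇔
    (λ ((⊔-closed , down-closed) , rest) → (⊔-closed , λ x y x∈I y⊑ᵒᵖx → down-closed y x x∈I (⊒ᵒᵖ⇒⊑ y⊑ᵒᵖx)) , rest)
    (λ ((⊔-closed , up-closedᵒᵖ) , rest) → (⊔-closed , λ x y y∈I x⊑y → up-closedᵒᵖ y x y∈I (⊑⇒⊒ᵒᵖ x⊑y)) , rest)

lemma4p11 : {ℓ : Level} → ExcludedMiddle (lsuc ℓ) → ZornSubsets ℓ →
    (𝐃 : DBA ℓ) →
      ((X : Fpr 𝐃 → Set (lsuc ℓ)) →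
        IsClopen (Fset 𝐃) X ⇔ (∃ λ x → X ≐ Fset 𝐃 x))
      ×
      ((Y : Ipr 𝐃 → Set (lsuc ℓ)) →
        IsClopen (Iset 𝐃) Y ⇔ (∃ λ x → Y ≐ Iset 𝐃 x))
lemma4p11 em zorn 𝐃 =
  ClopenSets.isClopen⇔≐subbasic em zorn 𝐃 (DBA.IsPrimaryFilter 𝐃) ⇔-refl ,
  ClopenSets.isClopen⇔≐subbasic em zorn (dual 𝐃) (DBA.IsPrimaryIdeal 𝐃)
    (Duality.isPrimaryIdeal⇔isPrimaryFilterᵒᵖ 𝐃)
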